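{- Let $G$ be a connected graph with $n$ vertices, diameter $d$ and price function $P$, and label the vertices so that their prices satisfy $p^{1}\le p^{2}\le\cdots\le p^{n}$. Then for every integer $1\le t\le n$, \[ \pi_{P}^{t}(G)\le t\Big[\Big(\prod_{i=n-(d-1)}^{n}p^{i}-1\Big)(n-1)+1\Big]. \]
   Context: A configuration of $k$ pebbles on a graph $G$ is a function $C:V(G)\to\mathbb{Z}_{\ge 0}$ with $\sum_{v}C(v)=k$. A price function is a function $P:V(G)\to\mathbb{Z}_{\ge 2}$. A pebbling move along an edge $v_hv_k$ removes $P(v_h)$ pebbles from $v_h$ and adds one pebble to $v_k$; it is allowed only if the result has no negative values. A configuration $C'$ is derivable from $C$ if it is obtained from $C$ by a finite sequence of pebbling moves. A configuration covers a set of vertices if it is nonzero at each of them. A configuration $C$ is $t$-solvable if for every set of $t$ vertices there is a configuration derivable from $C$ covering that set. For $1\le t\le n$, $\pi_P^t(G)$ is the minimum $k$ such that every configuration of $k$ pebbles on $G$ (with price function $P$) is $t$-solvable. -}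

module Defs where

open import Data.Nat using (ℕ; zero; suc; _+_; _*_; _∸_; _≤_; _<_; _≤?_)
open import Data.Fin using (Fin; toℕ) renaming (zero to fzero; suc to fsuc)
open import Data.Fin.Subset using (Subset; _∈_; ∣_∣)
open import Data.Product using (Σ; ∃; ∃-syntax; _×_; _,_)
open import Data.Empty using (⊥)
open import Relation.Nullary using (¬_; yes; no)
import Relation.Nullary
open import Relation.Binary.PropositionalEquality using (_≡_)
open import Relation.Binary.Construct.Closure.ReflexiveTransitive using (Star)

record Graph (n : ℕ) : Set₁ where
  field
    Adj     : Fin n → Fin n → Set
    symm    : ∀ {u v} → Adj u v → Adj v u
    irrefl  : ∀ {u} → ¬ Adj u u
open Graph public

data Walk {n : ℕ} (G : Graph n) : Fin n → Fin n → ℕ → Set where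
  here : ∀ {u} → Walk G u u 0
  step : ∀ {u v w ℓ} → Adj G u v → Walk G v w ℓ → Walk G u w (suc ℓ)

Connected : ∀ {n} → Graph n → Set
Connected G = ∀ u v → ∃[ ℓ ] Walk G u v ℓ

DistLe : ∀ {n} → Graph n → Fin n → Fin n → ℕ → Set
DistLe G u v ℓ = ∃[ m ] (m ≤ ℓ × Walk G u v m)

Diameter : ∀ {n} → Graph n → ℕ → Set
Diameter G d =
  (∀ u v → DistLe G u v d) ×
  (∃[ u ] ∃[ v ] (∀ m → Walk G u v m → d ≤ m))

sumF : ∀ {n} → (Fin n → ℕ) → ℕ
sumF {zero}  f = 0
sumF {suc n} f = f fzero + sumF (λ i → f (fsuc i))

prodF : ∀ {n} → (Fin n → ℕ) → ℕ
prodF {zero}  f = 1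
prodF {suc n} f = f fzero * prodF (λ i → f (fsuc i))

Config : ℕ → Set
Config n = Fin n → ℕ

Price : ℕ → Set
Price n = Fin n → ℕ

IsPrice : ∀ {n} → Price n → Set
IsPrice P = ∀ v → 2 ≤ P v

Move : ∀ {n} → Graph n → Price n → Config n → Config n → Set
Move G P C C' = ∃[ u ] ∃[ v ]
  ( Adj G u v
  × P u ≤ C u
  × C' u ≡ C u ∸ P u
  × C' v ≡ suc (C v)
  × (∀ w → ¬ w ≡ u → ¬ w ≡ v → C' w ≡ C w))

Derivable : ∀ {n} → Graph n → Price n → Config n → Config n → Set
Derivable G P = Star (Move G P)

Covers : ∀ {n} → Config n → Subset n → Set
Covers C S = ∀ v → v ∈ S → 0 < C v

Solvable : ∀ {n} → Graph n → Price n → ℕ → Config n → Set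
Solvable {n} G P t C =
  ∀ (S : Subset n) → ∣ S ∣ ≡ t → ∃[ C' ] (Derivable G P C C' × Covers C' S)

AllSolvable : ∀ {n} → Graph n → Price n → ℕ → ℕ → Set
AllSolvable G P t k = ∀ (C : Config _) → sumF C ≡ k → Solvable G P t C

-- π_P^t(G) ≤ B, i.e. the minimum k with AllSolvable is at most B
-- (equivalently: some k ≤ B has AllSolvable).
PebblingNumberAtMost : ∀ {n} → Graph n → Price n → ℕ → ℕ → Set
PebblingNumberAtMost G P t B = ∃[ k ] (k ≤ B × AllSolvable G P t k)

Sorted : ∀ {n} → Price n → Set
Sorted P = ∀ i j → toℕ i ≤ toℕ j → P i ≤ P j

-- Product of p^i for i = n-(d-1), ..., n (1-based), i.e. 0-based indices ≥ n ∸ d.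
topProd : ∀ {n} → Price n → ℕ → ℕ
topProd {n} P d = prodF (λ i → pick (n ∸ d ≤? toℕ i) (P i))
  where
    pick : ∀ {A : Set} → Relation.Nullary.Dec A → ℕ → ℕ
    pick (yes _) x = x
    pick (no _)  _ = 1

{-# OPTIONS --safe #-}
-- Let Π be the product of the d largest prices and X = (Π − 1)(n − 1) + 1. The targets are
-- served one at a time, each from a reserve of at most X pebbles, so t·X pebbles suffice. If
-- the target s holds a pebble, that pebble is the reserve. Otherwise the at least X pebbles lie
-- on the other n − 1 vertices, so some vertex u holds at least Π of them. A shortest walk from
-- u to s visits at most d distinct vertices before s, so sending one pebble along it costs a
-- product of at most d distinct prices, which is at most Π ≤ X. Adding idle pebbles does not
-- invalidate a derivation, so the reserve's derivation and the one serving the remaining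
-- targets from the remaining pebbles can be run one after the other.
module Submission where

open import Defs
open import Data.Nat using (ℕ; zero; suc; _+_; _*_; _∸_; _≤_; _<_; z≤n; s≤s; _≤?_; >-nonZero)
open import Data.Nat.Properties
open import Data.Fin using (Fin; toℕ) renaming (zero to fzero; suc to fsuc)
open import Data.Fin.Properties using (all?; ¬∀⟶∃¬) renaming (_≟_ to _≟ᶠ_)
open import Data.Fin.Subset using (Subset; inside; outside; _∈_; _∉_; ∣_∣; ⊥; ⁅_⁆; _∪_; _-_)
open import Data.Fin.Subset.Properties
  using (nonempty?; _∈?_; drop-not-there; x∈p∪q⁻; x∈⁅y⁆⇒x≡y; ∉⊥; ∪-identityˡ; ∣⊥∣≡0; ∣p∣≤n;
         ∣p∣≤∣x∷p∣; x∈p⇒∣p-x∣<∣p∣; x∈p∧x≢y⇒x∈p-y)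
open import Data.Vec using ([]; _∷_; here)
open import Data.Vec.Functional using (updateAt)
open import Data.Vec.Functional.Properties using (updateAt-updates; updateAt-minimal)
open import Data.Product using (Σ; ∃-syntax; _×_; _,_; proj₁)
open import Data.Sum using (inj₁; inj₂)
open import Function using (_∘_)
open import Relation.Nullary using (yes; no; contradiction)
open import Relation.Binary.PropositionalEquality
  using (_≡_; _≢_; refl; sym; trans; cong; cong₂; subst; module ≡-Reasoning)
open import Relation.Binary.Construct.Closure.ReflexiveTransitive using (ε; _◅_; _◅◅_)
open import Algebra.Properties.CommutativeSemigroup +-commutativeSemigroup using (xy∙z≈xz∙y)
open import Algebra.Properties.CommutativeSemigroup *-commutativeSemigroup using (x∙yz≈y∙xz)

private
  variable
    n k m c ℓ : ℕ

m+[o∸n]≤o : ∀ {m n o} → m ≤ n → m ≤ o → m + (o ∸ n) ≤ o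
m+[o∸n]≤o {m} {n} {o} m≤n m≤o with ≤-total n o
... | inj₁ n≤o = ≤-trans (+-monoˡ-≤ (o ∸ n) m≤n) (≤-reflexive (m+[n∸m]≡n n≤o))
... | inj₂ o≤n rewrite m≤n⇒m∸n≡0 o≤n | +-identityʳ m = m≤o

m≤[m∸1]*[k∸1]+1 : ∀ m {k} → 2 ≤ k → m ≤ (m ∸ 1) * (k ∸ 1) + 1
m≤[m∸1]*[k∸1]+1 zero    _ = z≤n
m≤[m∸1]*[k∸1]+1 (suc m) {suc zero} (s≤s ())
m≤[m∸1]*[k∸1]+1 (suc m) {suc (suc k)} _ = begin
  suc m         ≡⟨ +-comm 1 m ⟩
  m + 1         ≤⟨ +-monoˡ-≤ 1 (m≤m*n m (suc k)) ⟩
  m * suc k + 1 ∎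
  where open ≤-Reasoning

≢⇒2≤n : {u v : Fin n} → u ≢ v → 2 ≤ n
≢⇒2≤n {suc zero}    {fzero} {fzero} u≢v = contradiction refl u≢v
≢⇒2≤n {suc (suc n)} _                   = s≤s (s≤s z≤n)

sumF≤n*m : (f : Fin n → ℕ) → (∀ i → f i ≤ m) → sumF f ≤ n * m
sumF≤n*m {zero}  f f≤m = z≤n
sumF≤n*m {suc n} f f≤m = +-mono-≤ (f≤m fzero) (sumF≤n*m (f ∘ fsuc) (f≤m ∘ fsuc))

sumF≤[n∸1]*m : (f : Fin n → ℕ) (s : Fin n) → f s ≡ 0 → (∀ i → f i ≤ m) → sumF f ≤ (n ∸ 1) * m
sumF≤[n∸1]*m f fzero fs≡0 f≤m rewrite fs≡0 = sumF≤n*m (f ∘ fsuc) (f≤m ∘ fsuc)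
sumF≤[n∸1]*m {suc (suc n)} f (fsuc s) fs≡0 f≤m =
  +-mono-≤ (f≤m fzero) (sumF≤[n∸1]*m (f ∘ fsuc) s fs≡0 (f≤m ∘ fsuc))

point : Fin n → ℕ → Config n
point fzero    c fzero    = c
point fzero    c (fsuc v) = 0
point (fsuc u) c fzero    = 0
point (fsuc u) c (fsuc v) = point u c v

point-self : (u : Fin n) → point u c u ≡ c
point-self fzero    = refl
point-self (fsuc u) = point-self u

point≤ : (C : Config n) (u : Fin n) → c ≤ C u → ∀ v → point u c v ≤ C v
point≤ C fzero    c≤Cu fzero    = c≤Cu
point≤ C fzero    c≤Cu (fsuc v) = z≤n
point≤ C (fsuc u) c≤Cu fzero    = z≤n
point≤ C (fsuc u) c≤Cu (fsuc v) = point≤ (C ∘ fsuc) u c≤Cu v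

sumF-∸-point : (C : Config n) (u : Fin n) → c ≤ C u → sumF (λ v → C v ∸ point u c v) + c ≡ sumF C
sumF-∸-point {c = c} C fzero c≤Cu =
  trans (xy∙z≈xz∙y (C fzero ∸ c) _ c) (cong (_+ sumF (C ∘ fsuc)) (m∸n+n≡m c≤Cu))
sumF-∸-point {c = c} C (fsuc u) c≤Cu =
  trans (+-assoc (C fzero) _ c) (cong (C fzero +_) (sumF-∸-point (C ∘ fsuc) u c≤Cu))

budget-∸-point : (C : Config n) (u : Fin n) {b t : ℕ} → c ≤ C u → c ≤ b → suc t * b ≤ sumF C →
                 t * b ≤ sumF (λ v → C v ∸ point u c v)
budget-∸-point {c = c} C u {b} {t} c≤Cu c≤b budget = +-cancelˡ-≤ b _ _ (begin
  b + t * b      ≤⟨ budget ⟩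
  sumF C         ≡⟨ sym (sumF-∸-point C u c≤Cu) ⟩
  sumF rest + c  ≤⟨ +-monoʳ-≤ (sumF rest) c≤b ⟩
  sumF rest + b  ≡⟨ +-comm (sumF rest) b ⟩
  b + sumF rest  ∎)
  where
    open ≤-Reasoning
    rest : Config _
    rest v = C v ∸ point u c v

Covers-from-removal : {C D : Config n} {S : Subset n} {s : Fin n} →
                      0 < C s → (∀ v → D v ≤ C v) → Covers D (S - s) → Covers C S
Covers-from-removal {s = s} 0<Cs D≤C D-covers v v∈S with v ≟ᶠ s
... | yes refl = 0<Cs
... | no  v≢s  = ≤-trans (D-covers v (x∈p∧x≢y⇒x∈p-y v∈S v≢s)) (D≤C v)

prodOver : Subset n → (Fin n → ℕ) → ℕ
prodOver []            f = 1
prodOver (inside  ∷ S) f = f fzero * prodOver S (f ∘ fsuc)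
prodOver (outside ∷ S) f = prodOver S (f ∘ fsuc)

prodOver-⊥ : (f : Fin n → ℕ) → prodOver ⊥ f ≡ 1
prodOver-⊥ {zero}  f = refl
prodOver-⊥ {suc n} f = prodOver-⊥ (f ∘ fsuc)

prodOver-⁅x⁆∪ : (f : Fin n → ℕ) (x : Fin n) (S : Subset n) → x ∉ S →
                prodOver (⁅ x ⁆ ∪ S) f ≡ f x * prodOver S f
prodOver-⁅x⁆∪ f fzero    (inside  ∷ S) x∉S = contradiction here x∉S
prodOver-⁅x⁆∪ f fzero    (outside ∷ S) x∉S =
  cong (λ T → f fzero * prodOver T (f ∘ fsuc)) (∪-identityˡ S)
prodOver-⁅x⁆∪ f (fsuc x) (inside  ∷ S) x∉S = begin
  f fzero * prodOver (⁅ x ⁆ ∪ S) (f ∘ fsuc)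
    ≡⟨ cong (f fzero *_) (prodOver-⁅x⁆∪ (f ∘ fsuc) x S (drop-not-there x∉S)) ⟩
  f fzero * (f (fsuc x) * prodOver S (f ∘ fsuc))
    ≡⟨ x∙yz≈y∙xz (f fzero) (f (fsuc x)) (prodOver S (f ∘ fsuc)) ⟩
  f (fsuc x) * (f fzero * prodOver S (f ∘ fsuc))
    ∎
  where open ≡-Reasoning
prodOver-⁅x⁆∪ f (fsuc x) (outside ∷ S) x∉S = prodOver-⁅x⁆∪ (f ∘ fsuc) x S (drop-not-there x∉S)

∣⁅x⁆∪p∣≤1+∣p∣ : (x : Fin n) (p : Subset n) → ∣ ⁅ x ⁆ ∪ p ∣ ≤ suc ∣ p ∣
∣⁅x⁆∪p∣≤1+∣p∣ fzero    (b ∷ p) rewrite ∪-identityˡ p = s≤s (∣p∣≤∣x∷p∣ b p)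
∣⁅x⁆∪p∣≤1+∣p∣ (fsuc x) (inside  ∷ p) = s≤s (∣⁅x⁆∪p∣≤1+∣p∣ x p)
∣⁅x⁆∪p∣≤1+∣p∣ (fsuc x) (outside ∷ p) = ∣⁅x⁆∪p∣≤1+∣p∣ x p

-- The indices i with k ≤ toℕ i; for sorted prices, suffix (n ∸ d) indexes the d largest ones.
suffix : ℕ → Subset n
suffix {zero}  k       = []
suffix {suc n} zero    = inside ∷ suffix zero
suffix {suc n} (suc k) = outside ∷ suffix k

prodOver≤prodOver-suffix-zero : {f : Fin n → ℕ} → (∀ i → 0 < f i) →
                                (S : Subset n) → prodOver S f ≤ prodOver (suffix 0) f
prodOver≤prodOver-suffix-zero f>0 [] = ≤-refl
prodOver≤prodOver-suffix-zero {f = f} f>0 (inside ∷ S) =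
  *-monoʳ-≤ (f fzero) (prodOver≤prodOver-suffix-zero (f>0 ∘ fsuc) S)
prodOver≤prodOver-suffix-zero {f = f} f>0 (outside ∷ S) =
  ≤-trans (prodOver≤prodOver-suffix-zero (f>0 ∘ fsuc) S) (m≤n*m _ (f fzero) {{>-nonZero (f>0 fzero)}})

prodOver-suffix-suc : (f : Fin n → ℕ) {a : ℕ} → (∀ i → a ≤ f i) → k < n →
                      a * prodOver (suffix (suc k)) f ≤ prodOver (suffix k) f
prodOver-suffix-suc {n = suc n} {k = zero}  f a≤f _         = *-monoˡ-≤ _ (a≤f fzero)
prodOver-suffix-suc {n = suc n} {k = suc k} f a≤f (s≤s k<n) =
  prodOver-suffix-suc (f ∘ fsuc) (a≤f ∘ fsuc) k<n

Sorted-tail : {f : Fin (suc n) → ℕ} → Sorted f → Sorted (f ∘ fsuc)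
Sorted-tail sorted i j i≤j = sorted (fsuc i) (fsuc j) (s≤s i≤j)

prodOver≤prodOver-suffix : {f : Fin n → ℕ} → Sorted f → (∀ i → 0 < f i) →
                           (S : Subset n) → ∣ S ∣ + k ≤ n → prodOver S f ≤ prodOver (suffix k) f
prodOver≤prodOver-suffix {k = zero} _ f>0 S _ = prodOver≤prodOver-suffix-zero f>0 S
prodOver≤prodOver-suffix {suc n} {suc k} {f} sorted f>0 (inside ∷ S) fits = begin
  f fzero * prodOver S (f ∘ fsuc)
    ≤⟨ *-monoʳ-≤ (f fzero) (prodOver≤prodOver-suffix (Sorted-tail sorted) (f>0 ∘ fsuc) S (≤-pred fits)) ⟩
  f fzero * prodOver (suffix (suc k)) (f ∘ fsuc)
    ≤⟨ prodOver-suffix-suc (f ∘ fsuc) (λ i → sorted fzero (fsuc i) z≤n) (m+n≤o⇒n≤o _ (≤-pred fits)) ⟩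
  prodOver (suffix k) (f ∘ fsuc)
    ∎
  where open ≤-Reasoning
prodOver≤prodOver-suffix {suc n} {suc k} sorted f>0 (outside ∷ S) fits =
  prodOver≤prodOver-suffix (Sorted-tail sorted) (f>0 ∘ fsuc) S (≤-pred (subst (_≤ suc n) (+-suc _ k) fits))

prodF≡prodOver-suffix : {f g : Fin n → ℕ} →
                        (∀ i → k ≤ toℕ i → f i ≡ g i) → (∀ i → toℕ i < k → f i ≡ 1) →
                        prodF f ≡ prodOver (suffix k) g
prodF≡prodOver-suffix {zero} _ _ = refl
prodF≡prodOver-suffix {suc n} {zero} on off =
  cong₂ _*_ (on fzero z≤n) (prodF≡prodOver-suffix (λ i _ → on (fsuc i) z≤n) (λ i ()))
prodF≡prodOver-suffix {suc n} {suc k} on off =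
  trans (cong₂ _*_ (off fzero (s≤s z≤n))
                   (prodF≡prodOver-suffix (λ i → on (fsuc i) ∘ s≤s) (λ i → off (fsuc i) ∘ s≤s)))
        (*-identityˡ _)

topProd≡prodOver-suffix : (P : Price n) (d : ℕ) → topProd P d ≡ prodOver (suffix (n ∸ d)) P
topProd≡prodOver-suffix {n} P d = prodF≡prodOver-suffix selected unselected
  where
    -- The factors of topProd are chosen by a helper local to its definition; unification recovers them.
    factors : Σ (Fin n → ℕ) λ f → prodF f ≡ topProd P d
    factors = _ , refl

    selected : ∀ i → n ∸ d ≤ toℕ i → proj₁ factors i ≡ P i
    selected i n∸d≤i with n ∸ d ≤? toℕ i
    ... | yes _    = refl
    ... | no n∸d≰i = contradiction n∸d≤i n∸d≰i

    unselected : ∀ i → toℕ i < n ∸ d → proj₁ factors i ≡ 1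
    unselected i i<n∸d with n ∸ d ≤? toℕ i
    ... | yes n∸d≤i = contradiction i<n∸d (≤⇒≯ n∸d≤i)
    ... | no _      = refl

Adj⇒≢ : (G : Graph n) {u v : Fin n} → Adj G u v → u ≢ v
Adj⇒≢ G uv refl = irrefl G uv

module Walks {n : ℕ} (G : Graph n) where

  private
    variable
      u v s : Fin n

  support : Walk G u v ℓ → Subset n
  support here           = ⊥
  support (step {u} _ w) = ⁅ u ⁆ ∪ support w

  ∣support∣≤length : (w : Walk G u v ℓ) → ∣ support w ∣ ≤ ℓ
  ∣support∣≤length here           = ≤-reflexive (∣⊥∣≡0 n)
  ∣support∣≤length (step {u} _ w) =
    ≤-trans (∣⁅x⁆∪p∣≤1+∣p∣ u (support w)) (s≤s (∣support∣≤length w))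

  data Simple : Walk G u v ℓ → Set where
    here : Simple (here {u = u})
    step : {uv : Adj G u v} {w : Walk G v s ℓ} → u ∉ support w → Simple w → Simple (step uv w)

  Path≤ : Fin n → Fin n → ℕ → Set
  Path≤ u v ℓ = ∃[ m ] (m ≤ ℓ × Σ (Walk G u v m) Simple)

  Path≤-weaken : ℓ ≤ m → Path≤ u v ℓ → Path≤ u v m
  Path≤-weaken ℓ≤m (k , k≤ℓ , path) = k , ≤-trans k≤ℓ ℓ≤m , path

  trim : (w : Walk G v s ℓ) → Simple w → u ∈ support w → Path≤ u s ℓ
  trim here here u∈⊥ = contradiction u∈⊥ ∉⊥
  trim (step {v} vx w) (step v∉w simple) u∈vw with x∈p∪q⁻ ⁅ v ⁆ (support w) u∈vw
  ... | inj₁ u∈⁅v⁆ with refl ← x∈⁅y⁆⇒x≡y v u∈⁅v⁆ = _ , ≤-refl , step vx w , step v∉w simple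
  ... | inj₂ u∈w = Path≤-weaken (n≤1+n _) (trim w simple u∈w)

  shorten : Walk G u s ℓ → Path≤ u s ℓ
  shorten here = 0 , z≤n , here , here
  shorten (step {u} uv w) with shorten w
  ... | m , m≤ℓ , p , simple with u ∈? support p
  ...   | yes u∈p = Path≤-weaken (m≤n⇒m≤1+n m≤ℓ) (trim p simple u∈p)
  ...   | no  u∉p = suc m , s≤s m≤ℓ , step uv p , step u∉p simple

module Pebbling {n : ℕ} (G : Graph n) (P : Price n) where

  open Walks G

  private
    variable
      u v s : Fin n
      C D E C′ : Config n

  cost : Walk G u v ℓ → ℕ
  cost here           = 1
  cost (step {u} _ w) = P u * cost w

  cost-simple : {w : Walk G u v ℓ} → Simple w → cost w ≡ prodOver (support w) P
  cost-simple here = sym (prodOver-⊥ P)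
  cost-simple (step {u} {w = w} u∉w simple) =
    trans (cong (P u *_) (cost-simple simple)) (sym (prodOver-⁅x⁆∪ P u (support w) u∉w))

  moved : Fin n → Fin n → Config n → Config n
  moved u v C = updateAt (updateAt C u (_∸ P u)) v suc

  moved-source : u ≢ v → moved u v C u ≡ C u ∸ P u
  moved-source {u} {v} {C} u≢v = trans (updateAt-minimal u v _ u≢v) (updateAt-updates u C)

  moved-target : u ≢ v → moved u v C v ≡ suc (C v)
  moved-target {u} {v} {C} u≢v =
    trans (updateAt-updates v _) (cong suc (updateAt-minimal v u C (u≢v ∘ sym)))

  moved-elsewhere : ∀ w → w ≢ u → w ≢ v → moved u v C w ≡ C w
  moved-elsewhere {u} {v} {C} w w≢u w≢v =
    trans (updateAt-minimal w v _ w≢v) (updateAt-minimal w u C w≢u)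

  move : Adj G u v → P u ≤ C u → Move G P C (moved u v C)
  move {u} {v} uv Pu≤Cu =
    u , v , uv , Pu≤Cu , moved-source (Adj⇒≢ G uv) , moved-target (Adj⇒≢ G uv) , moved-elsewhere

  moves : Adj G u v → ∀ j → P u * j ≤ C u → ∃[ C′ ] (Derivable G P C C′ × C v + j ≤ C′ v)
  moves {C = C} uv zero _ = C , ε , ≤-reflexive (+-identityʳ _)
  moves {u} {v} {C} uv (suc j) Pu[1+j]≤Cu =
    let C′ , D , arrived = moves uv j Pu*j≤rest
    in  C′ , move uv Pu≤Cu ◅ D ,
        subst (_≤ C′ v) (trans (cong (_+ j) (moved-target u≢v)) (sym (+-suc (C v) j))) arrived
    where
      u≢v : u ≢ v
      u≢v = Adj⇒≢ G uv
      Pu+Pu*j≤Cu : P u + P u * j ≤ C u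
      Pu+Pu*j≤Cu = subst (_≤ C u) (*-suc (P u) j) Pu[1+j]≤Cu
      Pu≤Cu : P u ≤ C u
      Pu≤Cu = m+n≤o⇒m≤o (P u) Pu+Pu*j≤Cu
      Pu*j≤rest : P u * j ≤ moved u v C u
      Pu*j≤rest = subst (P u * j ≤_) (sym (moved-source u≢v))
                        (m+n≤o⇒m≤o∸n (P u * j) (subst (_≤ C u) (+-comm (P u) _) Pu+Pu*j≤Cu))

  transport : (w : Walk G u s ℓ) → cost w ≤ C u → ∃[ C′ ] (Derivable G P C C′ × 0 < C′ s)
  transport {C = C} here 0<Cu = C , ε , 0<Cu
  transport (step uv w) cost≤Cu =
    let C₁ , C⇒C₁ , arrived = moves uv (cost w) cost≤Cu
        C₂ , C₁⇒C₂ , reached = transport w (≤-trans (m≤n+m (cost w) _) arrived)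
    in  C₂ , C⇒C₁ ◅◅ C₁⇒C₂ , reached

  Move-+ : Move G P C D → (∀ v → C′ v ≡ C v + E v) → Move G P C′ (λ v → D v + E v)
  Move-+ {C} {D} {C′} {E} (u , v , uv , Pu≤Cu , source , target , elsewhere) C′≡C+E =
    u , v , uv , Pu≤C′u , source′ , trans (cong (_+ E v) target) (cong suc (sym (C′≡C+E v))) , elsewhere′
    where
      Pu≤C′u : P u ≤ C′ u
      Pu≤C′u = subst (P u ≤_) (sym (C′≡C+E u)) (≤-trans Pu≤Cu (m≤m+n (C u) (E u)))
      source′ : D u + E u ≡ C′ u ∸ P u
      source′ = begin
        D u + E u           ≡⟨ cong (_+ E u) source ⟩
        (C u ∸ P u) + E u   ≡⟨ sym (+-∸-comm (E u) Pu≤Cu) ⟩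
        (C u + E u) ∸ P u   ≡⟨ cong (_∸ P u) (sym (C′≡C+E u)) ⟩
        C′ u ∸ P u          ∎
        where open ≡-Reasoning
      elsewhere′ : ∀ w → w ≢ u → w ≢ v → D w + E w ≡ C′ w
      elsewhere′ w w≢u w≢v = trans (cong (_+ E w) (elsewhere w w≢u w≢v)) (sym (C′≡C+E w))

  lift : Derivable G P C D → (∀ v → C′ v ≡ C v + E v) →
         ∃[ D′ ] (Derivable G P C′ D′ × (∀ v → D′ v ≡ D v + E v))
  lift ε C′≡C+E = _ , ε , C′≡C+E
  lift {E = E} (first ◅ rest) C′≡C+E =
    let D′ , C₁+E⇒D′ , D′≡D+E = lift {E = E} rest (λ _ → refl)
    in  D′ , Move-+ first C′≡C+E ◅ C₁+E⇒D′ , D′≡D+E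

  cover-step : (q : Walk G u s ℓ) → cost q ≤ C u → Derivable G P (λ v → C v ∸ point u (cost q) v) D →
               ∃[ C′ ] (Derivable G P C C′ × 0 < C′ s × (∀ v → D v ≤ C′ v))
  cover-step {u} {s} {C = C} {D} q cost≤Cu rest =
    let R′ , R⇒R′ , reached = transport {C = point u (cost q)} q (≤-reflexive (sym (point-self u)))
        C₁ , C⇒C₁ , C₁≡D+R = lift rest (λ v → sym (m∸n+n≡m (point≤ C u cost≤Cu v)))
        C₂ , C₁⇒C₂ , C₂≡R′+D = lift R⇒R′ (λ v → trans (C₁≡D+R v) (+-comm (D v) _))
    in  C₂ , C⇒C₁ ◅◅ C₁⇒C₂ ,
        subst (0 <_) (sym (C₂≡R′+D s)) (≤-trans reached (m≤m+n _ _)) ,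
        λ v → subst (D v ≤_) (sym (C₂≡R′+D v)) (m≤n+m _ _)

module Solving {n : ℕ} (G : Graph n) {d : ℕ} (P : Price n)
               (close : ∀ u v → DistLe G u v d) (isPrice : IsPrice P) (sorted : Sorted P) where

  open Walks G
  open Pebbling G P

  Π : ℕ
  Π = topProd P d

  X : ℕ
  X = (Π ∸ 1) * (n ∸ 1) + 1

  path-cost≤Π : {u s : Fin n} {q : Walk G u s m} → Simple q → m ≤ d → cost q ≤ Π
  path-cost≤Π {q = q} simple m≤d = begin
    cost q                      ≡⟨ cost-simple simple ⟩
    prodOver (support q) P      ≤⟨ prodOver≤prodOver-suffix sorted P>0 (support q) fits ⟩
    prodOver (suffix (n ∸ d)) P ≡⟨ sym (topProd≡prodOver-suffix P d) ⟩
    Π                           ∎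
    where
      open ≤-Reasoning
      P>0 : ∀ i → 0 < P i
      P>0 i = ≤-trans (s≤s z≤n) (isPrice i)
      fits : ∣ support q ∣ + (n ∸ d) ≤ n
      fits = m+[o∸n]≤o (≤-trans (∣support∣≤length q) m≤d) (∣p∣≤n (support q))

  Route : Config n → Fin n → Set
  Route C s = ∃[ u ] ∃[ ℓ ] Σ (Walk G u s ℓ) λ q → cost q ≤ C u × cost q ≤ X

  far-route : (C : Config n) (s u : Fin n) → C s ≡ 0 → Π ∸ 1 < C u → Route C s
  far-route C s u Cs≡0 Π∸1<Cu =
    let m₀ , m₀≤d , w = close u s
        m , m≤m₀ , q , simple = shorten w
        cost≤Π = path-cost≤Π simple (≤-trans m≤m₀ m₀≤d)
    in  u , m , q , ≤-trans cost≤Π (≤-trans (m≤n+m∸n Π 1) Π∸1<Cu) ,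
        ≤-trans cost≤Π (m≤[m∸1]*[k∸1]+1 Π (≢⇒2≤n u≢s))
    where
      u≢s : u ≢ s
      u≢s u≡s = >⇒≢ (≤-trans (s≤s z≤n) Π∸1<Cu) (trans (cong C u≡s) Cs≡0)

  route : (C : Config n) → X ≤ sumF C → ∀ s → Route C s
  route C X≤ΣC s with C s ≟ 0
  ... | no Cs≢0 = s , 0 , here , n≢0⇒n>0 Cs≢0 , m≤n+m 1 _
  ... | yes Cs≡0 with all? (λ i → C i ≤? Π ∸ 1)
  ...   | yes poor =
    contradiction (≤-trans X≤ΣC (≤-trans (sumF≤[n∸1]*m C s Cs≡0 poor) (≤-reflexive (*-comm (n ∸ 1) (Π ∸ 1)))))
                  (m+1+n≰m _)
  ...   | no ¬poor =
    let u , Cu≰Π∸1 = ¬∀⟶∃¬ n _ (λ i → C i ≤? Π ∸ 1) ¬poor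
    in  far-route C s u Cs≡0 (≰⇒> Cu≰Π∸1)

  solve : ∀ t (S : Subset n) (C : Config n) → ∣ S ∣ ≤ t → t * X ≤ sumF C →
          ∃[ C′ ] (Derivable G P C C′ × Covers C′ S)
  solve t S C _ _ with nonempty? S
  ... | no ∄s = C , ε , λ v v∈S → contradiction (v , v∈S) ∄s
  solve zero    S C ∣S∣≤0   _      | yes (s , s∈S) =
    contradiction (<-≤-trans (x∈p⇒∣p-x∣<∣p∣ s∈S) ∣S∣≤0) λ ()
  solve (suc t) S C ∣S∣≤1+t budget | yes (s , s∈S) =
    let u , _ , q , cost≤Cu , cost≤X = route C (m+n≤o⇒m≤o X budget) s
        D , rest⇒D , D-covers = solve t (S - s) (λ v → C v ∸ point u (cost q) v)
                                      (≤-pred (<-≤-trans (x∈p⇒∣p-x∣<∣p∣ s∈S) ∣S∣≤1+t))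
                                      (budget-∸-point C u {X} {t} cost≤Cu cost≤X budget)
        C′ , C⇒C′ , 0<C′s , D≤C′ = cover-step q cost≤Cu rest⇒D
    in  C′ , C⇒C′ , Covers-from-removal 0<C′s D≤C′ D-covers

theorem10 : (n : ℕ) (G : Graph n) (d : ℕ) (P : Price n) →
    Connected G → Diameter G d → IsPrice P → Sorted P →
    (t : ℕ) → 1 ≤ t → t ≤ n →
    PebblingNumberAtMost G P t (t * ((topProd P d ∸ 1) * (n ∸ 1) + 1))
-- Connectivity is implied by the diameter, and the bound holds for every t.
theorem10 n G d P _ diameter isPrice sorted t _ _ =
  t * X , ≤-refl , λ C ΣC≡ S ∣S∣≡t → solve t S C (≤-reflexive ∣S∣≡t) (≤-reflexive (sym ΣC≡))
  where open Solving G P (proj₁ diameter) isPrice sorted
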